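{- Let $\vdash$ be a regular entailment relation for a commutative preordered group $G$, let $x\in G$ and let $A,B$ be nonempty finite subsets of $G$. If $A\vdash_x B$ and $A\vdash_{ -x}B$, then $A\vdash B$.
   Context: A commutative preordered group is an abelian group $G$ with a preorder $\leqslant$ such that $a\leqslant b$ implies $a+c\leqslant b+c$. $A,B,A',B'$ denote nonempty finite subsets of $G$; $a$ stands for $\{a\}$, $A,B$ for $A\cup B$, $A+y=\{a+y:a\in A\}$. A regular entailment relation for $G$ is a relation $A\vdash B$ between nonempty finite subsets such that: (R1) $A\vdash B$ if $A\supseteq A'$, $B\supseteq B'$ and $A'\vdash B'$; (R2) $A\vdash B$ if $A,y\vdash B$ and $A\vdash B,y$; (R3) $a\vdash b$ if $a\leqslant b$; (R4) $A\vdash B$ if $A+y\vdash B+y$; (R5) $a+u,b+v\vdash a+b,u+v$ for all $a,b,u,v\in G$. For $z\in G$, $A\vdash_z B$ means there exists an integer $p\geqslant0$ with $A,A+pz\vdash B$. -}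

module Defs where

open import Level using (Level; _⊔_; suc)
open import Data.Nat using (ℕ; zero) renaming (suc to sucℕ)
open import Data.Product using (∃)
open import Data.List.NonEmpty using (List⁺; [_]; _∷⁺_; _⁺++⁺_; toList) renaming (map to map⁺)
open import Data.List.Membership.Propositional using (_∈_)
open import Relation.Binary.PropositionalEquality using (_≡_)

record CommPreorderedGroup (c ℓ : Level) : Set (suc (c ⊔ ℓ)) where
  infixl 6 _+_
  infix 4 _≤_
  field
    Carrier  : Set c
    _+_      : Carrier → Carrier → Carrier
    0#       : Carrier
    -_       : Carrier → Carrier
    +-assoc  : ∀ a b c → (a + b) + c ≡ a + (b + c)
    +-identityˡ : ∀ a → 0# + a ≡ a
    -‿inverseˡ  : ∀ a → (- a) + a ≡ 0#
    +-comm   : ∀ a b → a + b ≡ b + a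
    _≤_      : Carrier → Carrier → Set ℓ
    ≤-refl   : ∀ {a} → a ≤ a
    ≤-trans  : ∀ {a b d} → a ≤ b → b ≤ d → a ≤ d
    ≤-+      : ∀ {a b} c → a ≤ b → a + c ≤ b + c

  _·_ : ℕ → Carrier → Carrier
  zero · z = 0#
  sucℕ p · z = z + (p · z)

module _ {c ℓ : Level} (G : CommPreorderedGroup c ℓ) where
  open CommPreorderedGroup G

  -- Nonempty finite subsets of G are represented by nonempty lists;
  -- A ⊇ A' means every element of A' is an element of A.
  -- Since (R1) makes ⊢ invariant under ⊇, ⊢ only depends on the underlying sets.
  Fin⁺ : Set c
  Fin⁺ = List⁺ Carrier

  _⊇_ : Fin⁺ → Fin⁺ → Set c
  A ⊇ A' = ∀ x → x ∈ toList A' → x ∈ toList A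

  _+ₛ_ : Fin⁺ → Carrier → Fin⁺
  A +ₛ y = map⁺ (λ a → a + y) A

  _,ₛ_ : Fin⁺ → Carrier → Fin⁺
  A ,ₛ y = A ⁺++⁺ [ y ]

  record IsRegularEntailment {r : Level} (_⊢_ : Fin⁺ → Fin⁺ → Set r) : Set (c ⊔ ℓ ⊔ r) where
    field
      R1 : ∀ {A B A' B'} → A ⊇ A' → B ⊇ B' → A' ⊢ B' → A ⊢ B
      R2 : ∀ {A B} y → (A ,ₛ y) ⊢ B → A ⊢ (B ,ₛ y) → A ⊢ B
      R3 : ∀ {a b} → a ≤ b → [ a ] ⊢ [ b ]
      R4 : ∀ {A B} y → (A +ₛ y) ⊢ (B +ₛ y) → A ⊢ B
      R5 : ∀ a b u v → ((a + u) ∷⁺ [ b + v ]) ⊢ ((a + b) ∷⁺ [ u + v ])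

  Entails-at : ∀ {r} → (Fin⁺ → Fin⁺ → Set r) → Carrier → Fin⁺ → Fin⁺ → Set (r)
  Entails-at _⊢_ z A B = ∃ λ (p : ℕ) → (A ⁺++⁺ (A +ₛ (p · z))) ⊢ B

-- From A, A+y ⊢ B one gets A, A+(k+1)y ⊢ B by cutting every a+y against
-- a, a+(k+1)y ⊢ a+y, which follows from (R5) by induction on k. Rescaling
-- A ⊢_x B by q+1 and A ⊢_{-x} B by p+1 therefore yields A, A+y ⊢ B and
-- A, A+z ⊢ B with y + z = 0. Cutting every a+y and then every a′+z leaves
-- only the sequents a, a′ ⊢ a+y, a′+z, which are instances of (R5).
module Submission where

open import Defs
open import Level using (Level)
open import Algebra.Bundles using (AbelianGroup)
open import Algebra.Consequences.Propositional using (comm∧idˡ⇒id; comm∧invˡ⇒inv)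
import Algebra.Properties.CommutativeMonoid.Mult as Multiplication
import Algebra.Properties.CommutativeSemigroup as CommutativeSemigroupProperties
open import Data.List using (List; []; _∷_; _++_)
open import Data.List.NonEmpty using (List⁺; [_]; _∷⁺_; _⁺++⁺_; toList)
open import Data.List.Properties using (++-assoc; ++-identityʳ)
open import Data.List.Membership.Propositional using (_∈_)
open import Data.List.Membership.Propositional.Properties using (∈-map⁺; ∈-map⁻)
open import Data.List.Relation.Binary.Subset.Propositional using (_⊆_)
open import Data.List.Relation.Binary.Subset.Propositional.Properties
  using (⊆-refl; ⊆-trans; ⊆-reflexive; xs⊆xs++ys; xs⊆ys++xs; ++⁺ˡ)
open import Data.List.Relation.Unary.All using (All; []; _∷_)
import Data.List.Relation.Unary.All as All
open import Data.List.Relation.Unary.Any using (here; there)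
open import Data.Nat using (zero; suc; _*_)
open import Data.Nat.Properties using (*-comm)
open import Data.Product using (_,_)
open import Function using (_∘_)
open import Relation.Binary.PropositionalEquality
  using (_≡_; refl; sym; trans; cong; cong₂; module ≡-Reasoning)
open import Relation.Binary.PropositionalEquality.Algebra using (isMagma)

All-∈⇒⊆ : ∀ {a} {A : Set a} {xs ys : List A} → All (_∈ ys) xs → xs ⊆ ys
All-∈⇒⊆ = All.lookup

module CommPreorderedGroupProperties {c ℓ : Level} (G : CommPreorderedGroup c ℓ) where
  open CommPreorderedGroup G

  abelianGroup : AbelianGroup c c
  abelianGroup = record
    { isAbelianGroup = record
      { isGroup = record
        { isMonoid = record
          { isSemigroup = record { isMagma = isMagma _+_ ; assoc = +-assoc }
          ; identity = comm∧idˡ⇒id +-comm +-identityˡ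
          }
        ; inverse = comm∧invˡ⇒inv +-comm -‿inverseˡ
        ; ⁻¹-cong = cong -_
        }
      ; comm = +-comm
      }
    }

  open AbelianGroup abelianGroup public using (identityʳ; inverseʳ)
  open CommutativeSemigroupProperties (AbelianGroup.commutativeSemigroup abelianGroup) public
    using (x∙yz≈y∙xz)
  open Multiplication (AbelianGroup.commutativeMonoid abelianGroup)
    using (_×_; ×-assocˡ; ×-distrib-+)

  ·≡× : ∀ n x → n · x ≡ n × x
  ·≡× zero    x = refl
  ·≡× (suc n) x = cong (x +_) (·≡× n x)

  ×-zeroʳ : ∀ n → n × 0# ≡ 0#
  ×-zeroʳ zero    = refl
  ×-zeroʳ (suc n) = trans (+-identityˡ (n × 0#)) (×-zeroʳ n)

  opposite-multiples-cancel : ∀ m n x → n · (m · x) + m · (n · (- x)) ≡ 0#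
  opposite-multiples-cancel m n x = begin
    n · (m · x) + m · (n · (- x))     ≡⟨ cong₂ _+_ (··≡×× n m x) (··≡×× m n (- x)) ⟩
    n × (m × x) + m × (n × (- x))     ≡⟨ cong₂ _+_ (×-assocˡ x n m) (×-assocˡ (- x) m n) ⟩
    (n * m) × x + (m * n) × (- x)     ≡⟨ cong (λ k → (n * m) × x + k × (- x)) (*-comm m n) ⟩
    (n * m) × x + (n * m) × (- x)     ≡⟨ sym (×-distrib-+ x (- x) (n * m)) ⟩
    (n * m) × (x + - x)               ≡⟨ cong ((n * m) ×_) (inverseʳ x) ⟩
    (n * m) × 0#                      ≡⟨ ×-zeroʳ (n * m) ⟩
    0#                                ∎
    where
    open ≡-Reasoning
    ··≡×× : ∀ n m x → n · (m · x) ≡ n × (m × x)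
    ··≡×× n m x = trans (·≡× n (m · x)) (cong (n ×_) (·≡× m x))

module RegularEntailmentProperties
    {c ℓ r : Level} (G : CommPreorderedGroup c ℓ)
    {_⊢_ : Fin⁺ G → Fin⁺ G → Set r} (R : IsRegularEntailment G _⊢_) where
  open CommPreorderedGroup G
  open IsRegularEntailment R
  open CommPreorderedGroupProperties G

  infixl 5 _,+_
  _,+_ : Fin⁺ G → Carrier → Fin⁺ G
  A ,+ y = A ⁺++⁺ _+ₛ_ G A y

  weaken : ∀ {A A′ B B′} → toList A ⊆ toList A′ → toList B ⊆ toList B′ → A ⊢ B → A′ ⊢ B′
  weaken A⊆A′ B⊆B′ = R1 (λ _ → A⊆A′) (λ _ → B⊆B′)

  multicut : ∀ Y {Γ Γ′ Δ} → toList Γ′ ⊆ toList Γ ++ Y → Γ′ ⊢ Δ →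
             (∀ {y} → y ∈ Y → Γ ⊢ _,ₛ_ G Δ y) → Γ ⊢ Δ
  multicut [] Γ′⊆Γ Γ′⊢Δ _ = weaken (⊆-trans Γ′⊆Γ (⊆-reflexive (++-identityʳ _))) ⊆-refl Γ′⊢Δ
  multicut (y ∷ Y) {Γ} {Γ′} Γ′⊆Γ,Y Γ′⊢Δ Γ⊢Δ,Y =
    R2 y (multicut Y Γ′⊆Γ,y,Y Γ′⊢Δ (weaken (xs⊆xs++ys _ _) ⊆-refl ∘ Γ⊢Δ,Y ∘ there))
         (Γ⊢Δ,Y (here refl))
    where
    Γ′⊆Γ,y,Y : toList Γ′ ⊆ toList (_,ₛ_ G Γ y) ++ Y
    Γ′⊆Γ,y,Y = ⊆-trans Γ′⊆Γ,Y (⊆-reflexive (sym (++-assoc (toList Γ) (y ∷ []) Y)))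

  cut-shifted : ∀ {A B Γ} y → toList A ⊆ toList Γ → (A ,+ y) ⊢ B →
                (∀ {a} → a ∈ toList A → Γ ⊢ _,ₛ_ G B (a + y)) → Γ ⊢ B
  cut-shifted {A} {B} {Γ} y A⊆Γ A,A+y⊢B Γ⊢B,a+y =
    multicut (toList (_+ₛ_ G A y)) (++⁺ˡ _ A⊆Γ) A,A+y⊢B Γ⊢B,b
    where
    Γ⊢B,b : ∀ {b} → b ∈ toList (_+ₛ_ G A y) → Γ ⊢ _,ₛ_ G B b
    Γ⊢B,b b∈A+y with ∈-map⁻ (_+ y) b∈A+y
    ... | _ , a∈A , refl = Γ⊢B,a+y a∈A

  exchange : ∀ a y {w b} → y + w ≡ b → (a ∷⁺ [ b ]) ⊢ (a + y ∷⁺ [ w ])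
  exchange a y {w} y+w≡b = weaken (All-∈⇒⊆ (here (identityʳ a) ∷ there (here y+w≡b) ∷ []))
                                  (All-∈⇒⊆ (here refl ∷ there (here (+-identityˡ w)) ∷ []))
                                  (R5 a y 0# w)

  interpolate : ∀ a y k → (a ∷⁺ [ a + suc k · y ]) ⊢ [ a + y ]
  interpolate a y zero =
    weaken (All-∈⇒⊆ (there (here (cong (a +_) (sym (identityʳ y)))) ∷ [])) ⊆-refl (R3 ≤-refl)
  interpolate a y (suc k) = R2 (a + suc k · y)
    (weaken (All-∈⇒⊆ (here refl ∷ there (there (here refl)) ∷ [])) ⊆-refl (interpolate a y k))
    (exchange a y (x∙yz≈y∙xz y a (suc k · y)))

  opposite-shifts : ∀ {y z} a a′ → y + z ≡ 0# → (a ∷⁺ [ a′ ]) ⊢ (a + y ∷⁺ [ a′ + z ])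
  opposite-shifts {y} {z} a a′ y+z≡0 = exchange a y y+[a′+z]≡a′
    where
    open ≡-Reasoning
    y+[a′+z]≡a′ : y + (a′ + z) ≡ a′
    y+[a′+z]≡a′ = begin
      y + (a′ + z)  ≡⟨ x∙yz≈y∙xz y a′ z ⟩
      a′ + (y + z)  ≡⟨ cong (a′ +_) y+z≡0 ⟩
      a′ + 0#       ≡⟨ identityʳ a′ ⟩
      a′            ∎

  shift-multiple : ∀ {A B} y k → (A ,+ y) ⊢ B → (A ,+ suc k · y) ⊢ B
  shift-multiple {A} {B} y k A,A+y⊢B = cut-shifted y (xs⊆xs++ys _ _) A,A+y⊢B λ a∈A →
    weaken (All-∈⇒⊆ (xs⊆xs++ys _ _ a∈A ∷ xs⊆ys++xs _ (toList A) (∈-map⁺ (_+ suc k · y) a∈A) ∷ []))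
           (xs⊆ys++xs _ (toList B))
           (interpolate _ y k)

  unshifted : ∀ {A B} → (A ,+ 0#) ⊢ B → A ⊢ B
  unshifted {A} {B} A,A+0⊢B = cut-shifted 0# ⊆-refl A,A+0⊢B λ {a} a∈A →
    weaken (All-∈⇒⊆ (a∈A ∷ [])) (All-∈⇒⊆ (xs⊆ys++xs _ (toList B) (here (sym (identityʳ a))) ∷ []))
           (R3 ≤-refl)

  cancel-opposite-shifts : ∀ {A B y z} → y + z ≡ 0# → (A ,+ y) ⊢ B → (A ,+ z) ⊢ B → A ⊢ B
  cancel-opposite-shifts {A} {B} {y} {z} y+z≡0 A,A+y⊢B A,A+z⊢B =
    cut-shifted y ⊆-refl A,A+y⊢B λ {a} a∈A →
    cut-shifted z ⊆-refl (weaken ⊆-refl (xs⊆xs++ys _ _) A,A+z⊢B) λ {a′} a′∈A →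
    weaken (All-∈⇒⊆ (a∈A ∷ a′∈A ∷ []))
           (All-∈⇒⊆ (xs⊆xs++ys _ (a′ + z ∷ []) (xs⊆ys++xs (a + y ∷ []) (toList B) (here refl))
                   ∷ xs⊆ys++xs (a′ + z ∷ []) (toList B ++ a + y ∷ []) (here refl) ∷ []))
           (opposite-shifts a a′ y+z≡0)

proposition1p7 : ∀ {c ℓ r : Level} (G : CommPreorderedGroup c ℓ)
    (_⊢_ : List⁺ (CommPreorderedGroup.Carrier G) → List⁺ (CommPreorderedGroup.Carrier G) → Set r)
    → IsRegularEntailment G _⊢_
    → ∀ (x : CommPreorderedGroup.Carrier G) (A B : List⁺ (CommPreorderedGroup.Carrier G))
    → Entails-at G _⊢_ x A B
    → Entails-at G _⊢_ (CommPreorderedGroup.-_ G x) A B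
    → A ⊢ B
proposition1p7 G _⊢_ R x A B = cancel
  where
  open CommPreorderedGroup G
  open CommPreorderedGroupProperties G
  open RegularEntailmentProperties G R

  cancel : Entails-at G _⊢_ x A B → Entails-at G _⊢_ (- x) A B → A ⊢ B
  cancel (zero , A,A⊢B) _ = unshifted A,A⊢B
  cancel _ (zero , A,A⊢B) = unshifted A,A⊢B
  cancel (suc p , A⊢ₓB) (suc q , A⊢₋ₓB) =
    cancel-opposite-shifts (opposite-multiples-cancel (suc p) (suc q) x)
      (shift-multiple (suc p · x) q A⊢ₓB)
      (shift-multiple (suc q · (- x)) p A⊢₋ₓB)
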